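{- Let $G=(V,E)$ be a graph with weights $\mathbf{w}:E\to\mathbb{R}_{\ge0}$, $k$ a positive integer and $\rho>0$. Let $C$ be a cut with $|H_{\mathbf{w},\rho}\cap C|<k$. Then $\mathsf{val}_{\mathbf{w}}(C)\le\mathsf{val}_{\mathbf{w}}(C,H_{\mathbf{w},\rho}\cap C)<\rho$ if and only if $\mathbf{w}_\rho(C)<k\rho$.
   Context: A cut is an edge set $C=\delta_G(S)$, $\emptyset\ne S\subsetneq V$. $\mathbf{w}(X)=\sum_{e\in X}\mathbf{w}(e)$. For a cut $C$ and $F\subseteq E$: $\mathsf{val}_{\mathbf{w}}(C,F)=\frac{\mathbf{w}(C\setminus F)}{k-|F|}$ if $F\subseteq C$ and $|F|<k$, else $\infty$; $\mathsf{val}_{\mathbf{w}}(C)=\min_{F\subseteq E}\mathsf{val}_{\mathbf{w}}(C,F)$. $\mathbf{w}_\rho(e)=\min\{\mathbf{w}(e),\rho\}$ and $H_{\mathbf{w},\rho}=\{e\in E:\mathbf{w}(e)\ge\rho\}$.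
   Formalization: The edge weights and the parameter ρ take rational values rather than real ones. -}

module Defs where

open import Data.Bool using (Bool; true; false; if_then_else_; _xor_; _∧_)
open import Data.Nat as ℕ using (ℕ; zero; suc; _∸_; _<ᵇ_)
open import Data.Integer using (+_)
open import Data.Fin using (Fin)
open import Data.Fin.Subset using (Subset; inside; outside; _∩_; _─_; ∣_∣; _⊆_)
open import Data.Fin.Subset.Properties using (_⊆?_)
open import Data.Vec using (Vec; []; _∷_; lookup; tabulate)
open import Data.List using (List; []; _∷_; map; foldr; _++_)
open import Data.List as L using ()
open import Data.Product using (_×_; proj₁; proj₂)
open import Data.Rational using (ℚ; 0ℚ; _+_; _*_; _/_; _⊓_; _≤_; _<_)
open import Data.Rational.Properties using (_≤?_)
open import Relation.Nullary using (does)

-- A (multi)graph G = (V, E) with V = Fin n, E = Fin m;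
-- edge e joins the endpoints  proj₁ (ends e)  and  proj₂ (ends e).
Ends : ℕ → ℕ → Set
Ends n m = Fin m → Fin n × Fin n

δ : ∀ {n m} → Ends n m → Subset n → Subset m
δ ends S = tabulate λ e → lookup S (proj₁ (ends e)) xor lookup S (proj₂ (ends e))

IsShore : ∀ {n} → Subset n → Set
IsShore {n} S = 0 ℕ.< ∣ S ∣ × ∣ S ∣ ℕ.< n

wsum : ∀ {m} → (Fin m → ℚ) → Subset m → ℚ
wsum w X = foldr _+_ 0ℚ (L.map (λ e → if lookup X e then w e else 0ℚ) (L.allFin _))

ℕ→ℚ : ℕ → ℚ
ℕ→ℚ k = + k / 1

wcap : ∀ {m} → (Fin m → ℚ) → ℚ → Fin m → ℚ
wcap w ρ e = w e ⊓ ρ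

H : ∀ {m} → (Fin m → ℚ) → ℚ → Subset m
H w ρ = tabulate λ e → does (ρ ≤? w e)

data ℚ∞ : Set where
  fin : ℚ → ℚ∞
  ∞   : ℚ∞

data _≤∞_ : ℚ∞ → ℚ∞ → Set where
  fin≤fin : ∀ {p q} → p ≤ q → fin p ≤∞ fin q
  _≤∞∞    : ∀ x → x ≤∞ ∞

data _<∞_ : ℚ∞ → ℚ∞ → Set where
  fin<fin : ∀ {p q} → p < q → fin p <∞ fin q
  fin<∞   : ∀ {p} → fin p <∞ ∞

min∞ : ℚ∞ → ℚ∞ → ℚ∞
min∞ (fin p) (fin q) = fin (p ⊓ q)
min∞ (fin p) ∞       = fin p
min∞ ∞       y       = y

-- p / d for a natural d (d = 0 never used by val)
divℕ : ℚ → ℕ → ℚ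
divℕ p zero    = 0ℚ
divℕ p (suc d) = p * (+ 1 / suc d)

valF : ∀ {m} → (Fin m → ℚ) → ℕ → Subset m → Subset m → ℚ∞
valF w k C F =
  if does (F ⊆? C) ∧ (∣ F ∣ <ᵇ k)
  then fin (divℕ (wsum w (C ─ F)) (k ∸ ∣ F ∣))
  else ∞

allSubsets : ∀ m → List (Subset m)
allSubsets zero    = [] ∷ []
allSubsets (suc m) = L.map (inside ∷_) (allSubsets m) ++ L.map (outside ∷_) (allSubsets m)

val : ∀ {m} → (Fin m → ℚ) → ℕ → Subset m → ℚ∞
val {m} w k C = foldr (λ F acc → min∞ (valF w k C F) acc) ∞ (allSubsets m)

{-# OPTIONS --safe #-}
module Submission where

-- Let F = H ∩ C be the heavy edges of C. Capping at ρ turns every heavy edge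
-- into an edge of weight exactly ρ and leaves the others alone, so
-- w_ρ(C) = w(C ∖ F) + |F| ρ, while val(C, F) = w(C ∖ F) / (k − |F|) with
-- k − |F| > 0. Hence val(C, F) < ρ iff w(C ∖ F) < (k − |F|) ρ iff w_ρ(C) < k ρ.
-- The other conjunct, val(C) ≤ val(C, F), always holds: val(C) is a minimum
-- over all F.

open import Defs
open import Level using (0ℓ)
open import Data.Bool using (true; false; if_then_else_)
open import Data.Bool.Properties using (T-≡)
open import Data.Nat as ℕ using (ℕ)
import Data.Nat.Properties as ℕ
open import Data.Nat.Coprimality as Coprime using (1-coprimeTo)
import Data.Integer as ℤ
import Data.Integer.Properties as ℤ
open import Data.Rational as ℚ using (ℚ; 0ℚ; 1ℚ; mkℚ; _/_; _+_; _*_; -_; _⊓_; _≤_; _<_)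
open import Data.Rational.Properties
open import Data.Rational.Solver using (module +-*-Solver)
open import Data.Fin using (Fin; zero; suc)
open import Data.Fin.Subset using (Subset; _∩_; _─_; _⊆_; ∣_∣)
open import Data.Fin.Subset.Properties using (_⊆?_; p∩q⊆q)
open import Data.Vec using ([]; _∷_; lookup)
open import Data.Vec.Properties using (lookup∘tabulate)
open import Data.List as List using (foldr)
open import Data.List.Properties using (map-tabulate; map-cong)
open import Data.List.Membership.Propositional using (_∈_)
open import Data.List.Membership.Propositional.Properties using (∈-map⁺; ∈-++⁺ˡ; ∈-++⁺ʳ)
open import Data.List.Relation.Unary.Any using (here; there)
open import Data.Product using (_×_; _,_)
open import Function using (_∘_; id)
open import Function.Bundles using (_⇔_; mk⇔; module Equivalence)
open import Function.Properties.Equivalence using (⇔-setoid)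
open import Relation.Binary.PropositionalEquality
open import Relation.Nullary using (Dec; does; yes; no)
open import Relation.Nullary.Decidable using (dec-true)
import Relation.Binary.Reasoning.Setoid as SetoidReasoning

module ⇔-Reasoning = SetoidReasoning (⇔-setoid 0ℓ)

ℕ→ℚ≡mkℚ : ∀ n → ℕ→ℚ n ≡ mkℚ (ℤ.+ n) 0 (Coprime.sym (1-coprimeTo n))
ℕ→ℚ≡mkℚ n = normalize-coprime (Coprime.sym (1-coprimeTo n))

ℕ→ℚ-homo-+ : ∀ a b → ℕ→ℚ (a ℕ.+ b) ≡ ℕ→ℚ a + ℕ→ℚ b
ℕ→ℚ-homo-+ a b = sym (begin
  ℕ→ℚ a + ℕ→ℚ b
    ≡⟨ cong₂ _+_ (ℕ→ℚ≡mkℚ a) (ℕ→ℚ≡mkℚ b) ⟩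
  (ℤ.+ a ℤ.* ℤ.+ 1 ℤ.+ ℤ.+ b ℤ.* ℤ.+ 1) / 1
    ≡⟨ cong₂ (λ x y → (x ℤ.+ y) / 1) (ℤ.*-identityʳ (ℤ.+ a)) (ℤ.*-identityʳ (ℤ.+ b)) ⟩
  ℕ→ℚ (a ℕ.+ b)
    ∎)
  where open ≡-Reasoning

1/n*n≡1 : ∀ d → (ℤ.+ 1 / ℕ.suc d) * ℕ→ℚ (ℕ.suc d) ≡ 1ℚ
1/n*n≡1 d = trans
  (cong₂ _*_ (normalize-coprime (1-coprimeTo (ℕ.suc d))) (ℕ→ℚ≡mkℚ (ℕ.suc d)))
  (*-inverseˡ (mkℚ (ℤ.+ ℕ.suc d) 0 (Coprime.sym (1-coprimeTo (ℕ.suc d)))))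

+-cancelʳ-< : ∀ r {p q} → p + r < q + r → p < q
+-cancelʳ-< r {p} {q} p+r<q+r =
  subst₂ _<_ (+-r-cancel p) (+-r-cancel q) (+-monoˡ-< (- r) p+r<q+r)
  where
  +-r-cancel : ∀ x → x + r + - r ≡ x
  +-r-cancel x = trans (+-assoc x r (- r))
    (trans (cong (x +_) (+-inverseʳ r)) (+-identityʳ x))

p<q⇔p+r<q+r : ∀ r {p q} → p < q ⇔ p + r < q + r
p<q⇔p+r<q+r r = mk⇔ (+-monoˡ-< r) (+-cancelʳ-< r)

p<q⇔p*r<q*r : ∀ r .{{_ : ℚ.Positive r}} {p q} → p < q ⇔ p * r < q * r
p<q⇔p*r<q*r r = mk⇔ (*-monoˡ-<-pos r) (*-cancelʳ-<-nonNeg r {{pos⇒nonNeg r}})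

divℕ<⇔<ℕ→ℚ* : ∀ p q {d} → 0 ℕ.< d → divℕ p d < q ⇔ p < ℕ→ℚ d * q
divℕ<⇔<ℕ→ℚ* p q {ℕ.suc d} _ = begin
  p * 1/n < q          ≈⟨ p<q⇔p*r<q*r n ⟩
  p * 1/n * n < q * n  ≡⟨ cong₂ _<_ p*1/n*n≡p (*-comm q n) ⟩
  p < n * q            ∎
  where
  open ⇔-Reasoning
  1/n n : ℚ
  1/n = ℤ.+ 1 / ℕ.suc d
  n = ℕ→ℚ (ℕ.suc d)
  instance
    n-pos : ℚ.Positive n
    n-pos = normalize-pos (ℕ.suc d) 1
  p*1/n*n≡p : p * 1/n * n ≡ p
  p*1/n*n≡p = trans (*-assoc p 1/n n) (trans (cong (p *_) (1/n*n≡1 d)) (*-identityʳ p))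

divℕ∸<⇔+ℕ→ℚ*<ℕ→ℚ* : ∀ p q {f k} → f ℕ.< k →
  divℕ p (k ℕ.∸ f) < q ⇔ p + ℕ→ℚ f * q < ℕ→ℚ k * q
divℕ∸<⇔+ℕ→ℚ*<ℕ→ℚ* p q {f} {k} f<k = begin
  divℕ p (k ℕ.∸ f) < q                         ≈⟨ divℕ<⇔<ℕ→ℚ* p q (ℕ.m<n⇒0<n∸m f<k) ⟩
  p < ℕ→ℚ (k ℕ.∸ f) * q                        ≈⟨ p<q⇔p+r<q+r (ℕ→ℚ f * q) ⟩
  p + ℕ→ℚ f * q < ℕ→ℚ (k ℕ.∸ f) * q + ℕ→ℚ f * q ≡⟨ cong (p + ℕ→ℚ f * q <_) [k∸f]q+fq≡kq ⟩
  p + ℕ→ℚ f * q < ℕ→ℚ k * q                    ∎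
  where
  open ⇔-Reasoning
  [k∸f]q+fq≡kq : ℕ→ℚ (k ℕ.∸ f) * q + ℕ→ℚ f * q ≡ ℕ→ℚ k * q
  [k∸f]q+fq≡kq = trans (sym (*-distribʳ-+ q (ℕ→ℚ (k ℕ.∸ f)) (ℕ→ℚ f)))
    (cong (_* q) (trans (sym (ℕ→ℚ-homo-+ (k ℕ.∸ f) f))
                        (cong ℕ→ℚ (ℕ.m∸n+n≡m (ℕ.<⇒≤ f<k)))))

fin<∞fin⇔< : ∀ {p q} → fin p <∞ fin q ⇔ p < q
fin<∞fin⇔< = mk⇔ (λ { (fin<fin p<q) → p<q }) fin<fin

≤∞-refl : ∀ x → x ≤∞ x
≤∞-refl (fin p) = fin≤fin ≤-refl
≤∞-refl ∞       = ∞ ≤∞∞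

≤∞-trans : ∀ {x y z} → x ≤∞ y → y ≤∞ z → x ≤∞ z
≤∞-trans (fin≤fin p≤q) (fin≤fin q≤r) = fin≤fin (≤-trans p≤q q≤r)
≤∞-trans _             (_ ≤∞∞)       = _ ≤∞∞

min∞-≤ˡ : ∀ x y → min∞ x y ≤∞ x
min∞-≤ˡ (fin p) (fin q) = fin≤fin (p⊓q≤p p q)
min∞-≤ˡ (fin p) ∞       = ≤∞-refl (fin p)
min∞-≤ˡ ∞       y       = y ≤∞∞

min∞-≤ʳ : ∀ x y → min∞ x y ≤∞ y
min∞-≤ʳ (fin p) (fin q) = fin≤fin (p⊓q≤q p q)
min∞-≤ʳ (fin p) ∞       = fin p ≤∞∞
min∞-≤ʳ ∞       y       = ≤∞-refl y

foldr-min∞-≤ : ∀ {A : Set} (g : A → ℚ∞) {a xs} → a ∈ xs →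
  foldr (λ x acc → min∞ (g x) acc) ∞ xs ≤∞ g a
foldr-min∞-≤ g {xs = x List.∷ _} (here refl) = min∞-≤ˡ (g x) _
foldr-min∞-≤ g {xs = x List.∷ _} (there a∈xs) =
  ≤∞-trans (min∞-≤ʳ (g x) _) (foldr-min∞-≤ g a∈xs)

∈-allSubsets : ∀ {m} (X : Subset m) → X ∈ allSubsets m
∈-allSubsets []          = here refl
∈-allSubsets (true ∷ X)  = ∈-++⁺ˡ (∈-map⁺ (true ∷_) (∈-allSubsets X))
∈-allSubsets {ℕ.suc m} (false ∷ X) =
  ∈-++⁺ʳ (List.map (true ∷_) (allSubsets m)) (∈-map⁺ (false ∷_) (∈-allSubsets X))

val≤valF : ∀ {m} (w : Fin m → ℚ) k (C F : Subset m) → val w k C ≤∞ valF w k C F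
val≤valF w k C F = foldr-min∞-≤ (valF w k C) (∈-allSubsets F)

valF-fin : ∀ {m} (w : Fin m → ℚ) k {C F : Subset m} → F ⊆ C → ∣ F ∣ ℕ.< k →
  valF w k C F ≡ fin (divℕ (wsum w (C ─ F)) (k ℕ.∸ ∣ F ∣))
valF-fin w k {C} {F} F⊆C ∣F∣<k
  rewrite dec-true (F ⊆? C) F⊆C | Equivalence.to T-≡ (ℕ.<⇒<ᵇ ∣F∣<k) = refl

wsum-∷ : ∀ {m} (u : Fin (ℕ.suc m) → ℚ) x (X : Subset m) →
  wsum u (x ∷ X) ≡ (if x then u zero else 0ℚ) + wsum (u ∘ suc) X
wsum-∷ u x X = cong (λ xs → (if x then u zero else 0ℚ) + foldr _+_ 0ℚ xs)
  (trans (map-tabulate suc term) (sym (map-tabulate id (term ∘ suc))))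
  where
  term : Fin _ → ℚ
  term e = if lookup (x ∷ X) e then u e else 0ℚ

wsum-cong : ∀ {m} {u v : Fin m → ℚ} → u ≗ v → ∀ X → wsum u X ≡ wsum v X
wsum-cong u≗v X = cong (foldr _+_ 0ℚ)
  (map-cong (λ e → cong (if lookup X e then_else 0ℚ) (u≗v e)) (List.allFin _))

wsum-if : ∀ {m} c (v : Fin m → ℚ) (h C : Subset m) →
  wsum (λ e → if lookup h e then c else v e) C ≡ wsum v (C ─ (h ∩ C)) + ℕ→ℚ ∣ h ∩ C ∣ * c
wsum-if c v []      []      = sym (trans (+-identityˡ _) (*-zeroˡ c))
wsum-if c v (b ∷ h) (x ∷ C) = begin
  wsum u (x ∷ C)                                 ≡⟨ wsum-∷ u x C ⟩
  (if x then u zero else 0ℚ) + wsum (u ∘ suc) C  ≡⟨ cong ((if x then u zero else 0ℚ) +_)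
                                                         (wsum-if c (v ∘ suc) h C) ⟩
  (if x then u zero else 0ℚ) + (W + N * c)       ≡⟨ regroup b x ⟩
  wsum v ((x ∷ C) ─ ((b ∷ h) ∩ (x ∷ C))) + ℕ→ℚ ∣ (b ∷ h) ∩ (x ∷ C) ∣ * c ∎
  where
  open ≡-Reasoning
  u : Fin _ → ℚ
  u e = if lookup (b ∷ h) e then c else v e
  D : Subset _
  D = C ─ (h ∩ C)
  W N : ℚ
  W = wsum (v ∘ suc) D
  N = ℕ→ℚ ∣ h ∩ C ∣
  reassoc : ∀ y → (if y then v zero else 0ℚ) + (W + N * c) ≡ wsum v (y ∷ D) + N * c
  reassoc y = trans (sym (+-assoc (if y then v zero else 0ℚ) W (N * c)))
                    (cong (_+ N * c) (sym (wsum-∷ v y D)))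
  regroup : ∀ b x → (if x then (if b then c else v zero) else 0ℚ) + (W + N * c)
          ≡ wsum v ((x ∷ C) ─ ((b ∷ h) ∩ (x ∷ C))) + ℕ→ℚ ∣ (b ∷ h) ∩ (x ∷ C) ∣ * c
  regroup true  true  = begin
    c + (W + N * c)
      ≡⟨ solve 3 (λ c W N → c :+ (W :+ N :* c) := (con 0ℚ :+ W) :+ (con 1ℚ :+ N) :* c) refl c W N ⟩
    (0ℚ + W) + (1ℚ + N) * c
      ≡⟨ cong₂ _+_ (sym (wsum-∷ v false D)) (cong (_* c) (sym (ℕ→ℚ-homo-+ 1 ∣ h ∩ C ∣))) ⟩
    wsum v (false ∷ D) + ℕ→ℚ (ℕ.suc ∣ h ∩ C ∣) * c
      ∎
    where open +-*-Solver
  regroup true  false = reassoc false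
  regroup false true  = reassoc true
  regroup false false = reassoc false

p⊓q≡if-q≤p : ∀ p q (q≤?p : Dec (q ≤ p)) → p ⊓ q ≡ (if does q≤?p then q else p)
p⊓q≡if-q≤p p q (yes q≤p) = p≥q⇒p⊓q≡q q≤p
p⊓q≡if-q≤p p q (no  q≰p) = p≤q⇒p⊓q≡p (<⇒≤ (≰⇒> q≰p))

wcap≗if-H : ∀ {m} (w : Fin m → ℚ) ρ → wcap w ρ ≗ λ e → if lookup (H w ρ) e then ρ else w e
wcap≗if-H w ρ e = trans (p⊓q≡if-q≤p (w e) ρ (ρ ≤? w e))
  (cong (if_then ρ else w e) (sym (lookup∘tabulate (λ e → does (ρ ≤? w e)) e)))

wsum-wcap : ∀ {m} (w : Fin m → ℚ) ρ (C : Subset m) →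
  wsum (wcap w ρ) C ≡ wsum w (C ─ (H w ρ ∩ C)) + ℕ→ℚ ∣ H w ρ ∩ C ∣ * ρ
wsum-wcap w ρ C = trans (wsum-cong (wcap≗if-H w ρ) C) (wsum-if ρ w (H w ρ) C)

valF[H∩C]<ρ⇔wsum-wcap<kρ : ∀ {m} (w : Fin m → ℚ) k ρ (C : Subset m) →
  ∣ H w ρ ∩ C ∣ ℕ.< k →
  valF w k C (H w ρ ∩ C) <∞ fin ρ ⇔ wsum (wcap w ρ) C < ℕ→ℚ k * ρ
valF[H∩C]<ρ⇔wsum-wcap<kρ w k ρ C ∣F∣<k = begin
  valF w k C F <∞ fin ρ                ≡⟨ cong (_<∞ fin ρ) (valF-fin w k (p∩q⊆q (H w ρ) C) ∣F∣<k) ⟩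
  fin (divℕ W (k ℕ.∸ ∣ F ∣)) <∞ fin ρ  ≈⟨ fin<∞fin⇔< ⟩
  divℕ W (k ℕ.∸ ∣ F ∣) < ρ             ≈⟨ divℕ∸<⇔+ℕ→ℚ*<ℕ→ℚ* W ρ ∣F∣<k ⟩
  W + ℕ→ℚ ∣ F ∣ * ρ < ℕ→ℚ k * ρ        ≡⟨ cong (_< ℕ→ℚ k * ρ) (sym (wsum-wcap w ρ C)) ⟩
  wsum (wcap w ρ) C < ℕ→ℚ k * ρ        ∎
  where
  open ⇔-Reasoning
  F : Subset _
  F = H w ρ ∩ C
  W : ℚ
  W = wsum w (C ─ F)

lemma4p3 : ∀ {n m} (ends : Ends n m) (w : Fin m → ℚ) → (∀ e → 0ℚ ≤ w e)
    → (k : ℕ) → 1 ℕ.≤ k → (ρ : ℚ) → 0ℚ < ρ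
    → (S : Subset n) → IsShore S
    → ∣ H w ρ ∩ δ ends S ∣ ℕ.< k
    → ((val w k (δ ends S) ≤∞ valF w k (δ ends S) (H w ρ ∩ δ ends S))
    × (valF w k (δ ends S) (H w ρ ∩ δ ends S) <∞ fin ρ))
    ⇔ (wsum (wcap w ρ) (δ ends S) < ℕ→ℚ k * ρ)
lemma4p3 {m = m} ends w _ k _ ρ _ S _ ∣F∣<k = mk⇔
  (λ (_ , valF<ρ) → Equivalence.to valF<ρ⇔ valF<ρ)
  (λ wcap<kρ → val≤valF w k C F , Equivalence.from valF<ρ⇔ wcap<kρ)
  where
  C F : Subset m
  C = δ ends S
  F = H w ρ ∩ C
  valF<ρ⇔ : valF w k C F <∞ fin ρ ⇔ wsum (wcap w ρ) C < ℕ→ℚ k * ρ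
  valF<ρ⇔ = valF[H∩C]<ρ⇔wsum-wcap<kρ w k ρ C ∣F∣<k
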